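{- Let $M\in\mathbb{Z}^{r\times n}$ (where $0<r\le n$) be a full-rank weakly unimodular matrix not containing any zero column. Then the set of signed circuits of $[M\mid -M]$ equals \[\{\pm(\mathbf{e}_i+\mathbf{e}_{n+i}) : i\in[n]\}\ \cup\ \bigcup_{J\subseteq[n]}\eta_J\big(\overrightarrow{\mathfrak{C}}(M)\big),\] where $\overrightarrow{\mathfrak{C}}(M)$ is the set of signed circuits of $M$ and $\mathbf{e}_1,\dots,\mathbf{e}_{2n}$ are the standard basis vectors of $\mathbb{Z}^{2n}$.
   Context: A matrix $M\in\mathbb{Z}^{r\times n}$ with $0<r\le n$ is full-rank weakly unimodular if it has rank $r$ and every $r\times r$ minor lies in $\{0,\pm1\}$. For a matrix $A$ with $q$ columns, circuits of $A$ are minimal linearly dependent sets of column indices, and a signed circuit of $A$ is a vector $\boldsymbol{\mu}\in\ker(A)\cap\mathbb{Z}^q$ with entries in $\{0,\pm1\}$ whose support is a circuit of $A$. For $J\subseteq[n]$, $\eta_J:\mathbb{Z}^n\to\mathbb{Z}^{2n}$ sends $(\lambda_1,\dots,\lambda_n)$ to $(\tilde\lambda_1,\dots,\tilde\lambda_{2n})$ where, for $i\in[n]$, $\tilde\lambda_i=0$ and $\tilde\lambda_{n+i}=-\lambda_i$ if $i\in J$, while $\tilde\lambda_i=\lambda_i$ and $\tilde\lambda_{n+i}=0$ if $i\notin J$. -}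

module Defs where

open import Data.Nat using (ℕ; zero; suc)
open import Data.Integer using (ℤ; +_; -_; _+_; _*_; 0ℤ; 1ℤ; -1ℤ; _≟_)
open import Data.Fin using (Fin; zero; suc; punchIn; _<_)
open import Data.Fin.Subset using (Subset; inside; outside; _∈_; _∉_; _⊂_)
open import Data.Vec using (tabulate)
open import Data.Vec.Functional using (_++_)
open import Data.Product using (Σ; ∃; _×_; _,_)
open import Data.Sum using (_⊎_)
open import Data.Bool using (if_then_else_)
open import Relation.Nullary using (¬_; does)
open import Relation.Binary.PropositionalEquality using (_≡_; _≢_)

Matrix : ℕ → ℕ → Set
Matrix r n = Fin r → Fin n → ℤ

sumFin : ∀ {n} → (Fin n → ℤ) → ℤ
sumFin {zero}  f = 0ℤ
sumFin {suc n} f = f zero + sumFin (λ i → f (suc i))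

sgn : ℕ → ℤ
sgn zero = 1ℤ
sgn (suc zero) = -1ℤ
sgn (suc (suc k)) = sgn k

toℕ' : ∀ {n} → Fin n → ℕ
toℕ' zero = zero
toℕ' (suc i) = suc (toℕ' i)

det : ∀ {n} → Matrix n n → ℤ
det {zero}  A = 1ℤ
det {suc n} A = sumFin (λ j → sgn (toℕ' j) * (A zero j * det (λ i k → A (suc i) (punchIn j k))))

Selection : ℕ → ℕ → Set
Selection r n = Σ (Fin r → Fin n) (λ σ → ∀ i j → i < j → σ i < σ j)

minor : ∀ {r n} → Matrix r n → Selection r n → ℤ
minor M (σ , _) = det (λ i j → M i (σ j))

-- Rank r of an r×n matrix: some r×r minor is nonzero (rank = largest size of a nonzero minor).
HasRank : ∀ {r n} → Matrix r n → ℕ → Set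
HasRank {r} M k = (k ≡ r) × ∃ (λ σ → minor M σ ≢ 0ℤ)

FullRankWeaklyUnimodular : ∀ {r n} → Matrix r n → Set
FullRankWeaklyUnimodular {r} M =
  HasRank M r × (∀ σ → (minor M σ ≡ 0ℤ) ⊎ (minor M σ ≡ 1ℤ) ⊎ (minor M σ ≡ -1ℤ))

NoZeroColumn : ∀ {r n} → Matrix r n → Set
NoZeroColumn M = ∀ j → ¬ (∀ i → M i j ≡ 0ℤ)

_·_ : ∀ {r n} → Matrix r n → (Fin n → ℤ) → (Fin r → ℤ)
(A · v) i = sumFin (λ j → A i j * v j)

InKernel : ∀ {r q} → Matrix r q → (Fin q → ℤ) → Set
InKernel A v = ∀ i → (A · v) i ≡ 0ℤ

-- A set S of column indices is linearly dependent: a nontrivial integer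
-- (equivalently rational) combination of the columns in S vanishes.
LinDep : ∀ {r q} → Matrix r q → Subset q → Set
LinDep A S = ∃ λ (v : _) → (∀ j → j ∉ S → v j ≡ 0ℤ) × (∃ λ j → v j ≢ 0ℤ) × InKernel A v

IsCircuit : ∀ {r q} → Matrix r q → Subset q → Set
IsCircuit A S = LinDep A S × (∀ T → T ⊂ S → ¬ LinDep A T)

support : ∀ {q} → (Fin q → ℤ) → Subset q
support v = tabulate (λ j → if does (v j ≟ 0ℤ) then outside else inside)

IsSignedCircuit : ∀ {r q} → Matrix r q → (Fin q → ℤ) → Set
IsSignedCircuit A v =
  InKernel A v × (∀ j → (v j ≡ 0ℤ) ⊎ (v j ≡ 1ℤ) ⊎ (v j ≡ -1ℤ)) × IsCircuit A (support v)

doubleNeg : ∀ {r n} → Matrix r n → Matrix r (n Data.Nat.+ n)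
doubleNeg M i = M i ++ (λ j → - M i j)

e : ∀ {n} → Fin n → Fin n → ℤ
e i j = if does (Data.Fin._≟_ i j) then 1ℤ else 0ℤ

ePair : ∀ {n} → Fin n → Fin (n Data.Nat.+ n) → ℤ
ePair i = e i ++ e i

negV : ∀ {q} → (Fin q → ℤ) → Fin q → ℤ
negV v j = - v j

η : ∀ {n} → Subset n → (Fin n → ℤ) → Fin (n Data.Nat.+ n) → ℤ
η J λ' = (λ i → if does (Data.Fin.Subset.Properties._∈?_ i J) then 0ℤ else λ' i)
      ++ (λ i → if does (Data.Fin.Subset.Properties._∈?_ i J) then - λ' i else 0ℤ)
  where import Data.Fin.Subset.Properties

_≐_ : ∀ {q} → (Fin q → ℤ) → (Fin q → ℤ) → Set
v ≐ w = ∀ j → v j ≡ w j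

InRHS : ∀ {r n} → Matrix r n → (Fin (n Data.Nat.+ n) → ℤ) → Set
InRHS {n = n} M v =
  (∃ λ (i : Fin n) → (v ≐ ePair i) ⊎ (v ≐ negV (ePair i)))
  ⊎ (∃ λ (J : Subset n) → ∃ λ μ → IsSignedCircuit M μ × (v ≐ η J μ))

-- Since [M | -M] v = M (v_L - v_R) for the halves v_L, v_R of v, a signed circuit v of [M | -M]
-- either has v_L and v_R both nonzero at some i, or has halves with disjoint supports.  In the
-- first case e_i + e_{n+i} is a kernel vector whose support lies in that of v, so minimality
-- forces v to be supported on {i, n+i}; as column i of M is nonzero, v_L = v_R there and
-- v = ±(e_i + e_{n+i}).  In the second case v = η_J(v_L - v_R) with J the support of v_R, and
-- since v ↦ v_L - v_R and η_J both preserve kernels, sign vectors and strict inclusion of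
-- supports between vectors of this shape, they exchange the signed circuits of [M | -M] of
-- this shape with those of M.
module Submission where

open import Defs
open import Data.Nat using (ℕ; _<_; _≤_; _+_)
open import Data.Fin using (Fin)
open import Data.Integer using (ℤ)
open import Function.Bundles using (_⇔_)

open import Data.Nat using (zero; suc)
open import Data.Fin using (zero; suc; _↑ˡ_; _↑ʳ_; splitAt) renaming (_≟_ to _≟ᶠ_)
open import Data.Fin.Properties using (splitAt⁻¹-↑ˡ; splitAt⁻¹-↑ʳ; suc-injective; all?; ¬∀⟶∃¬)
open import Data.Fin.Subset using (Subset; inside; outside; _∈_; _∉_; _⊂_)
open import Data.Fin.Subset.Properties using (_∈?_)
open import Data.Integer using (0ℤ; 1ℤ; -1ℤ; -_; _≟_)
  renaming (_+_ to _+ℤ_; _-_ to _-ℤ_; _*_ to _*ℤ_)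
import Data.Integer.Properties as ℤ
open import Data.Integer.Solver using (module +-*-Solver)
open import Algebra.Properties.CommutativeSemigroup ℤ.+-commutativeSemigroup using (interchange)
open import Data.Vec.Properties using ([]=⇒lookup; lookup⇒[]=; lookup∘tabulate; tabulate-cong)
open import Data.Vec.Functional.Properties using (lookup-++ˡ; lookup-++ʳ)
open import Data.Product using (∃; _×_; _,_; proj₁; proj₂)
open import Data.Sum using (_⊎_; inj₁; inj₂; [_,_]′)
open import Data.Bool using (if_then_else_)
open import Function using (id; _∘_)
open import Function.Bundles using (mk⇔)
open import Relation.Nullary using (¬_; Dec; yes; no; does; contradiction)
open import Relation.Nullary.Decidable using (_⊎-dec_; dec-true; dec-false)
open import Relation.Binary.PropositionalEquality
  using (_≡_; _≢_; refl; sym; trans; cong; cong₂; subst; module ≡-Reasoning)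

IsUnit : ℤ → Set
IsUnit x = x ≡ 1ℤ ⊎ x ≡ -1ℤ

ZeroOrUnit : ℤ → Set
ZeroOrUnit x = x ≡ 0ℤ ⊎ IsUnit x

IsUnit⇒≢0 : ∀ {x} → IsUnit x → x ≢ 0ℤ
IsUnit⇒≢0 (inj₁ refl) ()
IsUnit⇒≢0 (inj₂ refl) ()

IsUnit-neg : ∀ {x} → IsUnit x → IsUnit (- x)
IsUnit-neg (inj₁ refl) = inj₂ refl
IsUnit-neg (inj₂ refl) = inj₁ refl

ZeroOrUnit-neg : ∀ {x} → ZeroOrUnit x → ZeroOrUnit (- x)
ZeroOrUnit-neg = [ inj₁ ∘ cong -_ , inj₂ ∘ IsUnit-neg ]′

neg≡0⇒≡0 : ∀ {x} → - x ≡ 0ℤ → x ≡ 0ℤ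
neg≡0⇒≡0 = ℤ.neg-injective

infix 4 _≡±_

_≡±_ : ℤ → ℤ → Set
x ≡± y = x ≡ y ⊎ x ≡ - y

≡±-≡0 : ∀ {x y} → x ≡± y → y ≡ 0ℤ → x ≡ 0ℤ
≡±-≡0 (inj₁ refl) y≡0 = y≡0
≡±-≡0 (inj₂ refl) y≡0 = cong -_ y≡0

≡±-≢0 : ∀ {x y} → x ≡± y → y ≢ 0ℤ → x ≢ 0ℤ
≡±-≢0 (inj₁ refl) y≢0 = y≢0
≡±-≢0 (inj₂ refl) y≢0 = y≢0 ∘ neg≡0⇒≡0

≡±-sym : ∀ {x y} → x ≡± y → y ≡± x
≡±-sym (inj₁ refl) = inj₁ refl
≡±-sym (inj₂ refl) = inj₂ (sym (ℤ.neg-involutive _))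

≡±-ZeroOrUnit : ∀ {x y} → x ≡± y → ZeroOrUnit y → ZeroOrUnit x
≡±-ZeroOrUnit (inj₁ refl) = id
≡±-ZeroOrUnit (inj₂ refl) = ZeroOrUnit-neg

if-dec-yes : ∀ {P A : Set} (d : Dec P) {a b : A} → P → (if does d then a else b) ≡ a
if-dec-yes d p = cong (if_then _ else _) (dec-true d p)

if-dec-no : ∀ {P A : Set} (d : Dec P) {a b : A} → ¬ P → (if does d then a else b) ≡ b
if-dec-no d ¬p = cong (if_then _ else _) (dec-false d ¬p)

*-distribˡ-difference : ∀ a x y → a *ℤ x +ℤ - a *ℤ y ≡ a *ℤ (x -ℤ y)
*-distribˡ-difference = solve 3 (λ a x y → a :* x :+ :- a :* y := a :* (x :- y)) refl
  where open +-*-Solver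

sumFin-cong : ∀ {n} {f g : Fin n → ℤ} → f ≐ g → sumFin f ≡ sumFin g
sumFin-cong {zero}  f≐g = refl
sumFin-cong {suc n} f≐g = cong₂ _+ℤ_ (f≐g zero) (sumFin-cong (f≐g ∘ suc))

sumFin-+ : ∀ {n} (f g : Fin n → ℤ) → sumFin (λ i → f i +ℤ g i) ≡ sumFin f +ℤ sumFin g
sumFin-+ {zero}  f g = refl
sumFin-+ {suc n} f g =
  trans (cong (f zero +ℤ g zero +ℤ_) (sumFin-+ (f ∘ suc) (g ∘ suc)))
        (interchange (f zero) (g zero) _ _)

sumFin-↑ : ∀ m {n} (f : Fin (m + n) → ℤ) →
           sumFin f ≡ sumFin (λ i → f (i ↑ˡ n)) +ℤ sumFin (λ j → f (m ↑ʳ j))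
sumFin-↑ zero    f = sym (ℤ.+-identityˡ _)
sumFin-↑ (suc m) f = trans (cong (f zero +ℤ_) (sumFin-↑ m (f ∘ suc))) (sym (ℤ.+-assoc (f zero) _ _))

sumFin-zero : ∀ {n} (f : Fin n → ℤ) → (∀ i → f i ≡ 0ℤ) → sumFin f ≡ 0ℤ
sumFin-zero {zero}  f f≡0 = refl
sumFin-zero {suc n} f f≡0 = cong₂ _+ℤ_ (f≡0 zero) (sumFin-zero (f ∘ suc) (f≡0 ∘ suc))

sumFin-single : ∀ {n} (f : Fin n → ℤ) y → (∀ i → i ≢ y → f i ≡ 0ℤ) → sumFin f ≡ f y
sumFin-single f zero    f≡0 =
  trans (cong (f zero +ℤ_) (sumFin-zero (f ∘ suc) (λ i → f≡0 (suc i) λ ()))) (ℤ.+-identityʳ _)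
sumFin-single f (suc y) f≡0 =
  trans (cong₂ _+ℤ_ (f≡0 zero λ ())
                    (sumFin-single (f ∘ suc) y λ i i≢y → f≡0 (suc i) (i≢y ∘ suc-injective)))
        (ℤ.+-identityˡ _)

Nontrivial : ∀ {q} → (Fin q → ℤ) → Set
Nontrivial v = ∃ λ k → v k ≢ 0ℤ

infix 4 _⊑_ _⊏_

_⊑_ : ∀ {q} → (Fin q → ℤ) → (Fin q → ℤ) → Set
w ⊑ v = ∀ k → v k ≡ 0ℤ → w k ≡ 0ℤ

_⊏_ : ∀ {q} → (Fin q → ℤ) → (Fin q → ℤ) → Set
w ⊏ v = w ⊑ v × ∃ λ k → v k ≢ 0ℤ × w k ≡ 0ℤ

⊑-trans : ∀ {q} {u v w : Fin q → ℤ} → u ⊑ v → v ⊑ w → u ⊑ w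
⊑-trans u⊑v v⊑w k wk≡0 = u⊑v k (v⊑w k wk≡0)

⊏-respʳ : ∀ {q} {w v v′ : Fin q → ℤ} → v ≐ v′ → w ⊏ v → w ⊏ v′
⊏-respʳ v≐v′ (w⊑v , k , vk≢0 , wk≡0) =
  (λ j v′j≡0 → w⊑v j (trans (v≐v′ j) v′j≡0)) , k , (λ v′k≡0 → vk≢0 (trans (v≐v′ k) v′k≡0)) , wk≡0

module _ {q : ℕ} (v : Fin q → ℤ) where

  ∈support⇒≢0 : ∀ {j} → j ∈ support v → v j ≢ 0ℤ
  ∈support⇒≢0 {j} j∈ vj≡0 = contradiction inside≡outside λ ()
    where
    inside≡outside : inside ≡ outside
    inside≡outside = trans (sym ([]=⇒lookup j∈))
      (trans (lookup∘tabulate _ j) (cong (λ x → if does (x ≟ 0ℤ) then outside else inside) vj≡0))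

  ≢0⇒∈support : ∀ {j} → v j ≢ 0ℤ → j ∈ support v
  ≢0⇒∈support {j} vj≢0 = lookup⇒[]= j (support v)
    (trans (lookup∘tabulate _ j) (if-dec-no (v j ≟ 0ℤ) vj≢0))

  ∉support⇒≡0 : ∀ {j} → j ∉ support v → v j ≡ 0ℤ
  ∉support⇒≡0 {j} j∉ with v j ≟ 0ℤ
  ... | yes vj≡0 = vj≡0
  ... | no  vj≢0 = contradiction (≢0⇒∈support vj≢0) j∉

support-cong : ∀ {q} {v w : Fin q → ℤ} → v ≐ w → support v ≡ support w
support-cong v≐w =
  tabulate-cong (λ j → cong (λ x → if does (x ≟ 0ℤ) then outside else inside) (v≐w j))

⊏⇒support⊂ : ∀ {q} {w v : Fin q → ℤ} → w ⊏ v → support w ⊂ support v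
⊏⇒support⊂ {w = w} {v} (w⊑v , k , vk≢0 , wk≡0) =
  (λ j∈ → ≢0⇒∈support v λ vj≡0 → ∈support⇒≢0 w j∈ (w⊑v _ vj≡0)) ,
  k , ≢0⇒∈support v vk≢0 , (λ k∈ → ∈support⇒≢0 w k∈ wk≡0)

module _ {r q : ℕ} (A : Matrix r q) where

  InKernel-cong : ∀ {v w} → v ≐ w → InKernel A v → InKernel A w
  InKernel-cong v≐w Av≡0 m = trans (sumFin-cong λ j → cong (A m j *ℤ_) (sym (v≐w j))) (Av≡0 m)

  InKernel-zero : ∀ {w} → (∀ j → w j ≡ 0ℤ) → InKernel A w
  InKernel-zero w≡0 m = sumFin-zero _ λ j → trans (cong (A m j *ℤ_) (w≡0 j)) (ℤ.*-zeroʳ (A m j))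

  InKernel-single⇒≡0 : ∀ {w} y → InKernel A w → (∀ j → j ≢ y → w j ≡ 0ℤ) →
                        ¬ (∀ m → A m y ≡ 0ℤ) → w y ≡ 0ℤ
  InKernel-single⇒≡0 {w} y Aw≡0 w≡0 column≢0 with w y ≟ 0ℤ
  ... | yes wy≡0 = wy≡0
  ... | no  wy≢0 = contradiction (λ m → [ id , (λ wy≡0 → contradiction wy≡0 wy≢0) ]′
                                          (ℤ.i*j≡0⇒i≡0∨j≡0 (A m y) (Amy*wy≡0 m))) column≢0
    where
    Amy*wy≡0 : ∀ m → A m y *ℤ w y ≡ 0ℤ
    Amy*wy≡0 m = trans (sym (sumFin-single _ y λ j j≢y →
      trans (cong (A m j *ℤ_) (w≡0 j j≢y)) (ℤ.*-zeroʳ (A m j)))) (Aw≡0 m)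

  LinDep-support : ∀ {v} → InKernel A v → Nontrivial v → LinDep A (support v)
  LinDep-support {v} Av≡0 v≢0 = v , (λ j → ∉support⇒≡0 v) , v≢0 , Av≡0

  LinDep-support⇒nontrivial : ∀ {v} → LinDep A (support v) → Nontrivial v
  LinDep-support⇒nontrivial {v} (w , w≡0 , (j , wj≢0) , _) =
    j , λ vj≡0 → wj≢0 (w≡0 j λ j∈ → ∈support⇒≢0 v j∈ vj≡0)

  Minimal : (Fin q → ℤ) → Set
  Minimal v = ∀ w → InKernel A w → Nontrivial w → ¬ (w ⊏ v)

  circuit⇒minimal : ∀ {v} → IsCircuit A (support v) → Minimal v
  circuit⇒minimal (_ , noSmaller) w Aw≡0 w≢0 w⊏v =
    noSmaller (support w) (⊏⇒support⊂ w⊏v) (LinDep-support Aw≡0 w≢0)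

  minimal⇒circuit : ∀ {v} → InKernel A v → Nontrivial v → Minimal v → IsCircuit A (support v)
  minimal⇒circuit {v} Av≡0 v≢0 minimal = LinDep-support Av≡0 v≢0 , noSmaller
    where
    noSmaller : ∀ T → T ⊂ support v → ¬ LinDep A T
    noSmaller T (T⊆ , x , x∈ , x∉T) (u , u≡0 , u≢0 , Au≡0) =
      minimal u Au≡0 u≢0 (u⊑v , x , ∈support⇒≢0 v x∈ , u≡0 x x∉T)
      where
      u⊑v : u ⊑ v
      u⊑v k vk≡0 = u≡0 k λ k∈T → ∈support⇒≢0 v (T⊆ k∈T) vk≡0

  signedCircuit : ∀ {v} → InKernel A v → (∀ j → ZeroOrUnit (v j)) → Nontrivial v → Minimal v →
                  IsSignedCircuit A v
  signedCircuit Av≡0 units v≢0 minimal = Av≡0 , units , minimal⇒circuit Av≡0 v≢0 minimal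

  signedCircuit⇒nontrivial : ∀ {v} → IsSignedCircuit A v → Nontrivial v
  signedCircuit⇒nontrivial (_ , _ , dependent , _) = LinDep-support⇒nontrivial dependent

  signedCircuit⇒minimal : ∀ {v} → IsSignedCircuit A v → Minimal v
  signedCircuit⇒minimal (_ , _ , circuit) = circuit⇒minimal circuit

  IsSignedCircuit-resp : ∀ {v w} → v ≐ w → IsSignedCircuit A v → IsSignedCircuit A w
  IsSignedCircuit-resp v≐w (Av≡0 , units , circuit) =
    InKernel-cong v≐w Av≡0 , (λ j → subst ZeroOrUnit (v≐w j) (units j)) ,
    subst (IsCircuit A) (support-cong v≐w) circuit

e-diag : ∀ {m} (i : Fin m) → e i i ≡ 1ℤ
e-diag i = if-dec-yes (i ≟ᶠ i) refl

e-off : ∀ {m} {i j : Fin m} → i ≢ j → e i j ≡ 0ℤ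
e-off {i = i} {j} i≢j = if-dec-no (i ≟ᶠ j) i≢j

module _ {n : ℕ} where

  L R : Fin n → Fin (n + n)
  L i = i ↑ˡ n
  R i = n ↑ʳ i

  data Half : Fin (n + n) → Set where
    onL : ∀ i → Half (L i)
    onR : ∀ i → Half (R i)

  half : ∀ k → Half k
  half k with splitAt n k in eq
  ... | inj₁ i = subst Half (splitAt⁻¹-↑ˡ eq) (onL i)
  ... | inj₂ i = subst Half (splitAt⁻¹-↑ʳ eq) (onR i)

  ≐-byHalves : ∀ {v w : Fin (n + n) → ℤ} → (∀ i → v (L i) ≡ w (L i) × v (R i) ≡ w (R i)) → v ≐ w
  ≐-byHalves halves k with half k
  ... | onL i = proj₁ (halves i)
  ... | onR i = proj₂ (halves i)

  fold : (Fin (n + n) → ℤ) → Fin n → ℤ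
  fold v i = v (L i) -ℤ v (R i)

  fold-L : ∀ v {i} → v (R i) ≡ 0ℤ → fold v i ≡ v (L i)
  fold-L v {i} vR≡0 = trans (cong (λ x → v (L i) -ℤ x) vR≡0) (ℤ.+-identityʳ _)

  fold-R : ∀ v {i} → v (L i) ≡ 0ℤ → fold v i ≡ - v (R i)
  fold-R v {i} vL≡0 = trans (cong (_-ℤ v (R i)) vL≡0) (ℤ.+-identityˡ _)

  DisjointAt : (Fin (n + n) → ℤ) → Fin n → Set
  DisjointAt v i = v (L i) ≡ 0ℤ ⊎ v (R i) ≡ 0ℤ

  HalvesDisjoint : (Fin (n + n) → ℤ) → Set
  HalvesDisjoint v = ∀ i → DisjointAt v i

  disjointAt? : ∀ v i → Dec (DisjointAt v i)
  disjointAt? v i = (v (L i) ≟ 0ℤ) ⊎-dec (v (R i) ≟ 0ℤ)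

  halvesDisjoint? : ∀ v → HalvesDisjoint v ⊎ ∃ λ i → v (L i) ≢ 0ℤ × v (R i) ≢ 0ℤ
  halvesDisjoint? v with all? (disjointAt? v)
  ... | yes disjoint  = inj₁ disjoint
  ... | no  ¬disjoint with ¬∀⟶∃¬ n (DisjointAt v) (disjointAt? v) ¬disjoint
  ...   | i , ¬disjointAt = inj₂ (i , ¬disjointAt ∘ inj₁ , ¬disjointAt ∘ inj₂)

  ⊑-halvesDisjoint : ∀ {w v} → w ⊑ v → HalvesDisjoint v → HalvesDisjoint w
  ⊑-halvesDisjoint w⊑v disjoint i = [ inj₁ ∘ w⊑v (L i) , inj₂ ∘ w⊑v (R i) ]′ (disjoint i)

  module _ {v : Fin (n + n) → ℤ} (disjoint : HalvesDisjoint v) where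

    fold≡0⇒halves≡0 : ∀ {i} → fold v i ≡ 0ℤ → v (L i) ≡ 0ℤ × v (R i) ≡ 0ℤ
    fold≡0⇒halves≡0 {i} fold≡0 with disjoint i
    ... | inj₁ vL≡0 = vL≡0 , neg≡0⇒≡0 (trans (sym (fold-R v vL≡0)) fold≡0)
    ... | inj₂ vR≡0 = trans (sym (fold-L v vR≡0)) fold≡0 , vR≡0

    fold-≢0 : ∀ {i} → v (L i) ≢ 0ℤ ⊎ v (R i) ≢ 0ℤ → fold v i ≢ 0ℤ
    fold-≢0 {i} nonzero fold≡0 =
      [ (λ vL≢0 → vL≢0 (proj₁ halves≡0)) , (λ vR≢0 → vR≢0 (proj₂ halves≡0)) ]′ nonzero
      where
      halves≡0 : v (L i) ≡ 0ℤ × v (R i) ≡ 0ℤ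
      halves≡0 = fold≡0⇒halves≡0 fold≡0

    fold-nontrivial : Nontrivial v → Nontrivial (fold v)
    fold-nontrivial (k , vk≢0) with half k
    ... | onL i = i , fold-≢0 (inj₁ vk≢0)
    ... | onR i = i , fold-≢0 (inj₂ vk≢0)

    fold-ZeroOrUnit : (∀ k → ZeroOrUnit (v k)) → ∀ i → ZeroOrUnit (fold v i)
    fold-ZeroOrUnit units i with disjoint i
    ... | inj₁ vL≡0 = subst ZeroOrUnit (sym (fold-R v vL≡0)) (ZeroOrUnit-neg (units (R i)))
    ... | inj₂ vR≡0 = subst ZeroOrUnit (sym (fold-L v vR≡0)) (units (L i))

    fold-⊏ : ∀ {w} → w ⊏ v → fold w ⊏ fold v
    fold-⊏ {w} (w⊑v , x , vx≢0 , wx≡0) = fold-⊑ , strict (half x) vx≢0 wx≡0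
      where
      fold-⊑ : fold w ⊑ fold v
      fold-⊑ i fold≡0 = cong₂ _-ℤ_ (w⊑v (L i) (proj₁ halves≡0)) (w⊑v (R i) (proj₂ halves≡0))
        where
        halves≡0 : v (L i) ≡ 0ℤ × v (R i) ≡ 0ℤ
        halves≡0 = fold≡0⇒halves≡0 fold≡0
      strict : ∀ {x} → Half x → v x ≢ 0ℤ → w x ≡ 0ℤ → ∃ λ i → fold v i ≢ 0ℤ × fold w i ≡ 0ℤ
      strict (onL i) vL≢0 wL≡0 = i , fold-≢0 (inj₁ vL≢0) ,
        cong₂ _-ℤ_ wL≡0 (w⊑v (R i) ([ (λ vL≡0 → contradiction vL≡0 vL≢0) , id ]′ (disjoint i)))
      strict (onR i) vR≢0 wR≡0 = i , fold-≢0 (inj₂ vR≢0) ,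
        cong₂ _-ℤ_ (w⊑v (L i) ([ id , (λ vR≡0 → contradiction vR≡0 vR≢0) ]′ (disjoint i))) wR≡0

  η-at : ∀ (J : Subset n) i → (i ∈ J × (∀ u → η J u (L i) ≡ 0ℤ) × (∀ u → η J u (R i) ≡ - u i))
               ⊎ (i ∉ J × (∀ u → η J u (L i) ≡ u i) × (∀ u → η J u (R i) ≡ 0ℤ))
  η-at J i with i ∈? J
  ... | yes i∈J = inj₁ (i∈J , (λ u → trans (lookup-++ˡ _ _ i) (if-dec-yes (i ∈? J) i∈J))
                            , (λ u → trans (lookup-++ʳ {m = n} _ _ i) (if-dec-yes (i ∈? J) i∈J)))
  ... | no  i∉J = inj₂ (i∉J , (λ u → trans (lookup-++ˡ _ _ i) (if-dec-no (i ∈? J) i∉J))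
                            , (λ u → trans (lookup-++ʳ {m = n} _ _ i) (if-dec-no (i ∈? J) i∉J)))

  η-coordinate : ∀ (J : Subset n) k → (∀ u → η J u k ≡ 0ℤ) ⊎ ∃ λ i → ∀ u → η J u k ≡± u i
  η-coordinate J k with half k
  ... | onL i with η-at J i
  ...   | inj₁ (_ , ηL≡0 , _) = inj₁ ηL≡0
  ...   | inj₂ (_ , ηL≡u , _) = inj₂ (i , inj₁ ∘ ηL≡u)
  η-coordinate J k | onR i with η-at J i
  ...   | inj₁ (_ , _ , ηR≡-u) = inj₂ (i , inj₂ ∘ ηR≡-u)
  ...   | inj₂ (_ , _ , ηR≡0) = inj₁ ηR≡0

  η-hits : ∀ (J : Subset n) i → ∃ λ k → ∀ u → η J u k ≡± u i
  η-hits J i with η-at J i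
  ... | inj₁ (_ , _ , ηR≡-u) = R i , inj₂ ∘ ηR≡-u
  ... | inj₂ (_ , ηL≡u , _) = L i , inj₁ ∘ ηL≡u

  η-halvesDisjoint : ∀ (J : Subset n) u → HalvesDisjoint (η J u)
  η-halvesDisjoint J u i with η-at J i
  ... | inj₁ (_ , ηL≡0 , _) = inj₁ (ηL≡0 u)
  ... | inj₂ (_ , _ , ηR≡0) = inj₂ (ηR≡0 u)

  η-ZeroOrUnit : ∀ (J : Subset n) {u} → (∀ i → ZeroOrUnit (u i)) → ∀ k → ZeroOrUnit (η J u k)
  η-ZeroOrUnit J {u} units k with η-coordinate J k
  ... | inj₁ η≡0 = inj₁ (η≡0 u)
  ... | inj₂ (i , η≡±u) = ≡±-ZeroOrUnit (η≡±u u) (units i)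

  η-nontrivial : ∀ (J : Subset n) {u} → Nontrivial u → Nontrivial (η J u)
  η-nontrivial J {u} (i , ui≢0) = let k , η≡±u = η-hits J i in k , ≡±-≢0 (η≡±u u) ui≢0

  η-⊏ : ∀ (J : Subset n) {u μ} → u ⊏ μ → η J u ⊏ η J μ
  η-⊏ J {u} {μ} (u⊑μ , x , μx≢0 , ux≡0) with η-hits J x
  ... | k , η≡± = η-⊑ , k , ≡±-≢0 (η≡± μ) μx≢0 , ≡±-≡0 (η≡± u) ux≡0
    where
    η-⊑ : η J u ⊑ η J μ
    η-⊑ j ημ≡0 with η-coordinate J j
    ... | inj₁ η≡0 = η≡0 u
    ... | inj₂ (i , η≡±) = ≡±-≡0 (η≡± u) (u⊑μ i (≡±-≡0 (≡±-sym (η≡± μ)) ημ≡0))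

  fold-η : ∀ (J : Subset n) u → fold (η J u) ≐ u
  fold-η J u i with η-at J i
  ... | inj₁ (_ , ηL≡0 , ηR≡-u) =
    trans (cong₂ _-ℤ_ (ηL≡0 u) (ηR≡-u u)) (trans (ℤ.+-identityˡ _) (ℤ.neg-involutive (u i)))
  ... | inj₂ (_ , ηL≡u , ηR≡0) = trans (cong₂ _-ℤ_ (ηL≡u u) (ηR≡0 u)) (ℤ.+-identityʳ (u i))

  rightSupport : (Fin (n + n) → ℤ) → Subset n
  rightSupport v = support (v ∘ R)

  η-fold : ∀ {v} → HalvesDisjoint v → v ≐ η (rightSupport v) (fold v)
  η-fold {v} disjoint = ≐-byHalves halves
    where
    v′ : Fin (n + n) → ℤ
    v′ = η (rightSupport v) (fold v)
    halves : ∀ i → v (L i) ≡ v′ (L i) × v (R i) ≡ v′ (R i)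
    halves i with η-at (rightSupport v) i
    ... | inj₁ (i∈J , ηL≡0 , ηR≡-fold) =
      trans vL≡0 (sym (ηL≡0 (fold v))) ,
      trans (sym (ℤ.neg-involutive _))
            (trans (cong -_ (sym (fold-R v vL≡0))) (sym (ηR≡-fold (fold v))))
      where
      vL≡0 : v (L i) ≡ 0ℤ
      vL≡0 = [ id , (λ vR≡0 → contradiction vR≡0 (∈support⇒≢0 (v ∘ R) i∈J)) ]′ (disjoint i)
    ... | inj₂ (i∉J , ηL≡fold , ηR≡0) =
      trans (sym (fold-L v vR≡0)) (sym (ηL≡fold (fold v))) , trans vR≡0 (sym (ηR≡0 (fold v)))
      where
      vR≡0 : v (R i) ≡ 0ℤ
      vR≡0 = ∉support⇒≡0 (v ∘ R) i∉J

  ePair-L : ∀ (i : Fin n) → ePair i (L i) ≡ 1ℤ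
  ePair-L i = trans (lookup-++ˡ (e i) (e i) i) (e-diag i)

  ePair-R : ∀ (i : Fin n) → ePair i (R i) ≡ 1ℤ
  ePair-R i = trans (lookup-++ʳ (e i) (e i) i) (e-diag i)

  ePair-off : ∀ {i j : Fin n} → j ≢ i → ePair i (L j) ≡ 0ℤ × ePair i (R j) ≡ 0ℤ
  ePair-off {i} {j} j≢i = trans (lookup-++ˡ (e i) (e i) j) (e-off (j≢i ∘ sym)) ,
                          trans (lookup-++ʳ (e i) (e i) j) (e-off (j≢i ∘ sym))

  ePair-≢0 : ∀ {i : Fin n} {k} → ePair i k ≢ 0ℤ → k ≡ L i ⊎ k ≡ R i
  ePair-≢0 {i = i} {k} ePair≢0 with half k
  ... | onL j with j ≟ᶠ i
  ...   | yes refl = inj₁ refl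
  ...   | no  j≢i  = contradiction (proj₁ (ePair-off j≢i)) ePair≢0
  ePair-≢0 {i = i} {k} ePair≢0 | onR j with j ≟ᶠ i
  ...   | yes refl = inj₂ refl
  ...   | no  j≢i  = contradiction (proj₂ (ePair-off j≢i)) ePair≢0

  ⊑ePair⇒fold-off : ∀ {w i j} → w ⊑ ePair i → j ≢ i → fold w j ≡ 0ℤ
  ⊑ePair⇒fold-off w⊑e j≢i =
    cong₂ _-ℤ_ (w⊑e _ (proj₁ (ePair-off j≢i))) (w⊑e _ (proj₂ (ePair-off j≢i)))

  ⊑ePair⇒trivial : ∀ {w i} → w ⊑ ePair i → w (L i) ≡ 0ℤ → w (R i) ≡ 0ℤ → ¬ Nontrivial w
  ⊑ePair⇒trivial {w} {i} w⊑e wL≡0 wR≡0 (k , wk≢0) with ePair i k ≟ 0ℤ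
  ... | yes e≡0 = wk≢0 (w⊑e k e≡0)
  ... | no  e≢0 with ePair-≢0 {i = i} e≢0
  ...   | inj₁ refl = wk≢0 wL≡0
  ...   | inj₂ refl = wk≢0 wR≡0

  IsPair : Fin n → (Fin (n + n) → ℤ) → Set
  IsPair i v = v ⊑ ePair i × v (L i) ≡ v (R i) × IsUnit (v (L i))

  ePair-isPair : ∀ i → IsPair i (ePair i)
  ePair-isPair i = (λ _ → id) , trans (ePair-L i) (sym (ePair-R i)) , inj₁ (ePair-L i)

  negV-isPair : ∀ {i v} → IsPair i v → IsPair i (negV v)
  negV-isPair (v⊑e , vL≡vR , unit) =
    (λ k e≡0 → cong -_ (v⊑e k e≡0)) , cong -_ vL≡vR , IsUnit-neg unit

  isPair-ZeroOrUnit : ∀ {i v} → IsPair i v → ∀ k → ZeroOrUnit (v k)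
  isPair-ZeroOrUnit {i} (v⊑e , vL≡vR , unit) k with ePair i k ≟ 0ℤ
  ... | yes e≡0 = inj₁ (v⊑e k e≡0)
  ... | no  e≢0 with ePair-≢0 {i = i} e≢0
  ...   | inj₁ refl = inj₂ unit
  ...   | inj₂ refl = inj₂ (subst IsUnit vL≡vR unit)

  isPair-≐ : ∀ {i v w} → IsPair i v → IsPair i w → v (L i) ≡ w (L i) → v ≐ w
  isPair-≐ {i} (v⊑e , vL≡vR , _) (w⊑e , wL≡wR , _) vL≡wL k with ePair i k ≟ 0ℤ
  ... | yes e≡0 = trans (v⊑e k e≡0) (sym (w⊑e k e≡0))
  ... | no  e≢0 with ePair-≢0 {i = i} e≢0
  ...   | inj₁ refl = vL≡wL
  ...   | inj₂ refl = trans (sym vL≡vR) (trans vL≡wL wL≡wR)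

  isPair⇒±ePair : ∀ {i v} → IsPair i v → v ≐ ePair i ⊎ v ≐ negV (ePair i)
  isPair⇒±ePair {i} pair@(_ , _ , inj₁ vL≡1) =
    inj₁ (isPair-≐ pair (ePair-isPair i) (trans vL≡1 (sym (ePair-L i))))
  isPair⇒±ePair {i} pair@(_ , _ , inj₂ vL≡-1) =
    inj₂ (isPair-≐ pair (negV-isPair (ePair-isPair i)) (trans vL≡-1 (sym (cong -_ (ePair-L i)))))

module _ {r n : ℕ} (M : Matrix r n) where

  doubleNeg-· : ∀ v → (doubleNeg M · v) ≐ (M · fold v)
  doubleNeg-· v m = begin
    sumFin (λ k → doubleNeg M m k *ℤ v k)
      ≡⟨ sumFin-↑ n _ ⟩
    sumFin (λ (i : Fin n) → doubleNeg M m (L i) *ℤ v (L i)) +ℤ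
    sumFin (λ (i : Fin n) → doubleNeg M m (R i) *ℤ v (R i))
      ≡⟨ cong₂ _+ℤ_ (sumFin-cong λ i → cong (_*ℤ v (L i)) (lookup-++ˡ (M m) (λ j → - M m j) i))
                    (sumFin-cong λ i → cong (_*ℤ v (R i)) (lookup-++ʳ (M m) (λ j → - M m j) i)) ⟩
    sumFin (λ i → M m i *ℤ v (L i)) +ℤ sumFin (λ i → - M m i *ℤ v (R i))
      ≡⟨ sym (sumFin-+ (λ i → M m i *ℤ v (L i)) (λ i → - M m i *ℤ v (R i))) ⟩
    sumFin (λ i → M m i *ℤ v (L i) +ℤ - M m i *ℤ v (R i))
      ≡⟨ sumFin-cong (λ i → *-distribˡ-difference (M m i) (v (L i)) (v (R i))) ⟩
    sumFin (λ i → M m i *ℤ fold v i) ∎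
    where open ≡-Reasoning

  InKernel-doubleNeg⁻ : ∀ {v} → InKernel (doubleNeg M) v → InKernel M (fold v)
  InKernel-doubleNeg⁻ {v} Dv≡0 m = trans (sym (doubleNeg-· v m)) (Dv≡0 m)

  InKernel-doubleNeg⁺ : ∀ {v} → InKernel M (fold v) → InKernel (doubleNeg M) v
  InKernel-doubleNeg⁺ {v} Mfold≡0 m = trans (doubleNeg-· v m) (Mfold≡0 m)

  InKernel-η : ∀ (J : Subset n) {u} → InKernel M u → InKernel (doubleNeg M) (η J u)
  InKernel-η J {u} Mu≡0 = InKernel-doubleNeg⁺ (InKernel-cong M (λ i → sym (fold-η J u i)) Mu≡0)

  η-signedCircuit : ∀ (J : Subset n) {μ} → IsSignedCircuit M μ →
                    IsSignedCircuit (doubleNeg M) (η J μ)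
  η-signedCircuit J {μ} sc@(Mμ≡0 , units , _) = signedCircuit (doubleNeg M)
    (InKernel-η J Mμ≡0) (η-ZeroOrUnit J units) (η-nontrivial J (signedCircuit⇒nontrivial M sc))
    minimal
    where
    minimal : Minimal (doubleNeg M) (η J μ)
    minimal w Dw≡0 w≢0 w⊏ημ = signedCircuit⇒minimal M sc (fold w) (InKernel-doubleNeg⁻ Dw≡0)
      (fold-nontrivial (⊑-halvesDisjoint (proj₁ w⊏ημ) (η-halvesDisjoint J μ)) w≢0)
      (⊏-respʳ (fold-η J μ) (fold-⊏ (η-halvesDisjoint J μ) w⊏ημ))

  fold-signedCircuit : ∀ {v} → HalvesDisjoint v → IsSignedCircuit (doubleNeg M) v →
                       IsSignedCircuit M (fold v)
  fold-signedCircuit {v} disjoint sc@(Dv≡0 , units , _) = signedCircuit M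
    (InKernel-doubleNeg⁻ Dv≡0) (fold-ZeroOrUnit disjoint units)
    (fold-nontrivial disjoint (signedCircuit⇒nontrivial (doubleNeg M) sc)) minimal
    where
    minimal : Minimal M (fold v)
    minimal u Mu≡0 u≢0 u⊏fold = signedCircuit⇒minimal (doubleNeg M) sc (η (rightSupport v) u)
      (InKernel-η _ Mu≡0) (η-nontrivial _ u≢0)
      (⊏-respʳ (λ k → sym (η-fold disjoint k)) (η-⊏ _ u⊏fold))

  module _ (noZero : NoZeroColumn M) where

    ⊑ePair⇒balanced : ∀ {w} {i : Fin n} → InKernel (doubleNeg M) w → w ⊑ ePair i → w (L i) ≡ w (R i)
    ⊑ePair⇒balanced {w} {i} Dw≡0 w⊑e = ℤ.i-j≡0⇒i≡j _ _
      (InKernel-single⇒≡0 M i (InKernel-doubleNeg⁻ Dw≡0) (λ j → ⊑ePair⇒fold-off w⊑e) (noZero i))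

    isPair⇒signedCircuit : ∀ {i : Fin n} {v} → IsPair i v → IsSignedCircuit (doubleNeg M) v
    isPair⇒signedCircuit {i} {v} pair@(v⊑e , vL≡vR , unit) = signedCircuit (doubleNeg M)
      (InKernel-doubleNeg⁺ (InKernel-zero M fold≡0)) (isPair-ZeroOrUnit pair)
      (L i , IsUnit⇒≢0 unit) minimal
      where
      fold≡0 : ∀ j → fold v j ≡ 0ℤ
      fold≡0 j with j ≟ᶠ i
      ... | yes refl = trans (cong (v (L i) -ℤ_) (sym vL≡vR)) (ℤ.+-inverseʳ (v (L i)))
      ... | no  j≢i  = ⊑ePair⇒fold-off v⊑e j≢i
      minimal : Minimal (doubleNeg M) v
      minimal w Dw≡0 w≢0 (w⊑v , x , vx≢0 , wx≡0) =
        ⊑ePair⇒trivial w⊑e (proj₁ bothZero) (proj₂ bothZero) w≢0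
        where
        w⊑e : w ⊑ ePair i
        w⊑e = ⊑-trans w⊑v v⊑e
        wL≡wR : w (L i) ≡ w (R i)
        wL≡wR = ⊑ePair⇒balanced Dw≡0 w⊑e
        bothZero : w (L i) ≡ 0ℤ × w (R i) ≡ 0ℤ
        bothZero with ePair-≢0 {i = i} (vx≢0 ∘ v⊑e x)
        ... | inj₁ x≡L = wL≡0 , trans (sym wL≡wR) wL≡0
          where
          wL≡0 : w (L i) ≡ 0ℤ
          wL≡0 = subst (λ y → w y ≡ 0ℤ) x≡L wx≡0
        ... | inj₂ x≡R = trans wL≡wR wR≡0 , wR≡0
          where
          wR≡0 : w (R i) ≡ 0ℤ
          wR≡0 = subst (λ y → w y ≡ 0ℤ) x≡R wx≡0

    signedCircuit⇒isPair : ∀ {i : Fin n} {v} → IsSignedCircuit (doubleNeg M) v →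
                           v (L i) ≢ 0ℤ → v (R i) ≢ 0ℤ → IsPair i v
    signedCircuit⇒isPair {i} {v} sc@(Dv≡0 , units , _) vL≢0 vR≢0 =
      v⊑e , ⊑ePair⇒balanced Dv≡0 v⊑e , [ (λ vL≡0 → contradiction vL≡0 vL≢0) , id ]′ (units (L i))
      where
      e⊑v : ePair i ⊑ v
      e⊑v k vk≡0 with ePair i k ≟ 0ℤ
      ... | yes e≡0 = e≡0
      ... | no  e≢0 with ePair-≢0 {i = i} e≢0
      ...   | inj₁ refl = contradiction vk≡0 vL≢0
      ...   | inj₂ refl = contradiction vk≡0 vR≢0
      ePairCircuit : IsSignedCircuit (doubleNeg M) (ePair i)
      ePairCircuit = isPair⇒signedCircuit (ePair-isPair i)
      v⊑e : v ⊑ ePair i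
      v⊑e k e≡0 with v k ≟ 0ℤ
      ... | yes vk≡0 = vk≡0
      ... | no  vk≢0 = contradiction (e⊑v , k , vk≢0 , e≡0)
        (signedCircuit⇒minimal (doubleNeg M) sc (ePair i)
          (proj₁ ePairCircuit) (signedCircuit⇒nontrivial (doubleNeg M) ePairCircuit))

lemma6p4 : (r n : ℕ) → 0 < r → r ≤ n → (M : Matrix r n) →
    FullRankWeaklyUnimodular M → NoZeroColumn M →
    (v : Fin (n + n) → ℤ) → IsSignedCircuit (doubleNeg M) v ⇔ InRHS M v
lemma6p4 r n _ _ M _ noZero v = mk⇔ to from
  where
  to : IsSignedCircuit (doubleNeg M) v → InRHS M v
  to sc with halvesDisjoint? v
  ... | inj₁ disjoint =
    inj₂ (rightSupport v , fold v , fold-signedCircuit M disjoint sc , η-fold disjoint)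
  ... | inj₂ (i , vL≢0 , vR≢0) =
    inj₁ (i , isPair⇒±ePair (signedCircuit⇒isPair M noZero sc vL≢0 vR≢0))

  from : InRHS M v → IsSignedCircuit (doubleNeg M) v
  from (inj₁ (i , inj₁ v≐e)) = IsSignedCircuit-resp (doubleNeg M) (sym ∘ v≐e)
    (isPair⇒signedCircuit M noZero (ePair-isPair i))
  from (inj₁ (i , inj₂ v≐-e)) = IsSignedCircuit-resp (doubleNeg M) (sym ∘ v≐-e)
    (isPair⇒signedCircuit M noZero (negV-isPair (ePair-isPair i)))
  from (inj₂ (J , μ , sc , v≐ημ)) = IsSignedCircuit-resp (doubleNeg M) (sym ∘ v≐ημ)
    (η-signedCircuit M J sc)
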